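{- Let $n,t$ be positive integers and $x\ge 0$. If $\mathcal C\subseteq\mathcal P(n)$ satisfies $|\mathcal C|\ge H(n,t)+x$, then there are at least $x\frac{n}{2t}$ (unordered) pairs of distinct sets $A,B\in\mathcal C$ with Hamming distance $d(A,B)\le 2t$.
   Context: The Hamming distance is $d(A,B)=|A\setminus B|+|B\setminus A|$. Let $V(n,t)=\sum_{k=0}^t\binom nk$ and $H(n,t)=2^n/V(n,t)$.
   Formalization: The parameter x ranges over the nonnegative rationals. -}

module Defs where

open import Data.Nat using (ℕ; zero; suc; _+_; _*_; _^_; _≤_; _≤?_; NonZero; >-nonZero; z<s)
open import Data.Nat.Properties using (m≤n+m)
open import Data.Nat.Combinatorics using (_C_)
open import Data.Integer using (+_)
open import Data.Rational using (ℚ; _/_)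
open import Data.List using (List; []; _∷_; length; filter)
open import Data.Fin.Subset using (Subset; _─_; ∣_∣)

d : ∀ {n} → Subset n → Subset n → ℕ
d A B = ∣ A ─ B ∣ + ∣ B ─ A ∣

V : ℕ → ℕ → ℕ
V n zero    = n C 0
V n (suc t) = V n t + n C (suc t)

V-pos : ∀ n t → 1 ≤ V n t
V-pos n zero    = Data.Nat.s≤s Data.Nat.z≤n
V-pos n (suc t) = Data.Nat.Properties.≤-trans (V-pos n t) (Data.Nat.Properties.m≤m+n (V n t) (n C suc t))

V-nonZero : ∀ n t → NonZero (V n t)
V-nonZero n t = >-nonZero (V-pos n t)

H : ℕ → ℕ → ℚ
H n t = _/_ (+ (2 ^ n)) (V n t) {{V-nonZero n t}}

-- number of unordered pairs {A,B} of (distinct positions in the list, hence,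
-- for a duplicate-free list, distinct) members with d(A,B) ≤ 2t
closePairs : ∀ {n} → ℕ → List (Subset n) → ℕ
closePairs t []       = 0
closePairs t (A ∷ Cs) = length (filter (λ B → d A B ≤? 2 * t) Cs) + closePairs t Cs

-- Double counting over the cube {0,1}^n. A point y lies in the radius-t balls of N(y)
-- codewords, and N(y) ≤ 1 + (number of pairs of codewords whose balls both contain y).
-- Summing over y gives |𝒞| V(n,t) ≤ 2^n + Σ |B(A,t) ∩ B(B,t)| over pairs; balls around
-- distinct centres share at most 2 V(n−1,t−1) points and are disjoint once d(A,B) > 2t,
-- so |𝒞| V(n,t) ≤ 2^n + 2 V(n−1,t−1) P with P the number of close pairs. Finally
-- n V(n−1,t−1) ≤ t V(n,t) turns x ≤ |𝒞| − 2^n / V(n,t) into x n / 2t ≤ P.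
module Submission where

open import Defs

module HammingBalls where

  open import Data.Bool using (Bool; true; false)
  open import Data.Empty using (⊥-elim)
  open import Function using (_∘_)
  open import Data.List using (List; []; _∷_; length; filter)
  open import Data.List.Properties using (filter-accept; filter-reject)
  open import Data.List.Relation.Unary.All using (All; []; _∷_)
  open import Data.List.Relation.Unary.AllPairs using ([]; _∷_)
  open import Data.List.Relation.Unary.Unique.Propositional using (Unique)
  open import Data.Nat
  open import Data.Nat.Combinatorics using (_C_; nC1≡n; nCk+nC[k+1]≡[n+1]C[k+1])
  open import Data.Nat.Properties
  open import Data.Nat.Solver using (module +-*-Solver)
  open import Data.Vec using (Vec; []; _∷_)
  open import Relation.Binary.PropositionalEquality
  open import Relation.Nullary using (¬_; yes; no)
  open import Algebra.Properties.CommutativeSemigroup +-commutativeSemigroup using (interchange)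

  open +-*-Solver

  [k+1]*[n+1]C[k+1]≡[n+1]*nCk : ∀ n k → suc k * (suc n C suc k) ≡ suc n * (n C k)
  [k+1]*[n+1]C[k+1]≡[n+1]*nCk zero    zero    = refl
  [k+1]*[n+1]C[k+1]≡[n+1]*nCk zero    (suc k) = *-zeroʳ (suc (suc k))
  [k+1]*[n+1]C[k+1]≡[n+1]*nCk (suc n) zero    =
    trans (+-identityʳ _) (trans (nC1≡n (suc (suc n))) (sym (*-identityʳ (suc (suc n)))))
  [k+1]*[n+1]C[k+1]≡[n+1]*nCk (suc n) (suc k) = begin
    suc (suc k) * (suc (suc n) C suc (suc k))
      ≡⟨ cong (suc (suc k) *_) (nCk+nC[k+1]≡[n+1]C[k+1] (suc n) (suc k)) ⟨
    suc (suc k) * (a + b)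
      ≡⟨ solve 3 (λ k a b → (con 2 :+ k) :* (a :+ b) := a :+ ((con 1 :+ k) :* a :+ (con 2 :+ k) :* b)) refl k a b ⟩
    a + (suc k * a + suc (suc k) * b)
      ≡⟨ cong₂ (λ u v → a + (u + v)) ([k+1]*[n+1]C[k+1]≡[n+1]*nCk n k) ([k+1]*[n+1]C[k+1]≡[n+1]*nCk n (suc k)) ⟩
    a + (suc n * (n C k) + suc n * (n C suc k))
      ≡⟨ cong (a +_) (*-distribˡ-+ (suc n) (n C k) (n C suc k)) ⟨
    a + suc n * (n C k + n C suc k)
      ≡⟨ cong (λ u → a + suc n * u) (nCk+nC[k+1]≡[n+1]C[k+1] n k) ⟩
    suc (suc n) * a
      ∎
    where
    open ≡-Reasoning
    a = suc n C suc k
    b = suc n C suc (suc k)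

  V-pascal : ∀ m t → V m t + V m (suc t) ≡ V (suc m) (suc t)
  V-pascal m zero    = cong (1 +_) (nCk+nC[k+1]≡[n+1]C[k+1] m 0)
  V-pascal m (suc t) = begin
    V m (suc t) + (V m (suc t) + m C suc (suc t))
      ≡⟨ interchange (V m t) (m C suc t) (V m (suc t)) (m C suc (suc t)) ⟩
    (V m t + V m (suc t)) + (m C suc t + m C suc (suc t))
      ≡⟨ cong₂ _+_ (V-pascal m t) (nCk+nC[k+1]≡[n+1]C[k+1] m (suc t)) ⟩
    V (suc m) (suc t) + suc m C suc (suc t)
      ∎
    where open ≡-Reasoning

  V-zero-dim : ∀ t → V 0 t ≡ 1
  V-zero-dim zero    = refl
  V-zero-dim (suc t) = trans (+-identityʳ _) (V-zero-dim t)

  V⁻ : ℕ → ℕ → ℕ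
  V⁻ m zero    = 0
  V⁻ m (suc t) = V m t

  V⁻+V≡V : ∀ m t → V⁻ m t + V m t ≡ V (suc m) t
  V⁻+V≡V m zero    = refl
  V⁻+V≡V m (suc t) = V-pascal m t

  [m+1]*V≤[t+1]*V : ∀ m t → suc m * V m t ≤ suc t * V (suc m) (suc t)
  [m+1]*V≤[t+1]*V m zero    = begin
    suc m * 1            ≡⟨ *-identityʳ (suc m) ⟩
    suc m                ≡⟨ nC1≡n (suc m) ⟨
    suc m C 1            ≤⟨ m≤n+m _ 1 ⟩
    V (suc m) 1          ≡⟨ *-identityˡ _ ⟨
    1 * V (suc m) 1      ∎
    where open ≤-Reasoning
  [m+1]*V≤[t+1]*V m (suc t) = begin
    suc m * (V m t + m C suc t)
      ≡⟨ *-distribˡ-+ (suc m) (V m t) (m C suc t) ⟩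
    suc m * V m t + suc m * (m C suc t)
      ≤⟨ +-monoˡ-≤ _ ([m+1]*V≤[t+1]*V m t) ⟩
    suc t * V (suc m) (suc t) + suc m * (m C suc t)
      ≡⟨ cong (suc t * V (suc m) (suc t) +_) ([k+1]*[n+1]C[k+1]≡[n+1]*nCk m (suc t)) ⟨
    suc t * V (suc m) (suc t) + suc (suc t) * (suc m C suc (suc t))
      ≤⟨ +-monoˡ-≤ _ (*-monoˡ-≤ (V (suc m) (suc t)) (n≤1+n (suc t))) ⟩
    suc (suc t) * V (suc m) (suc t) + suc (suc t) * (suc m C suc (suc t))
      ≡⟨ *-distribˡ-+ (suc (suc t)) (V (suc m) (suc t)) (suc m C suc (suc t)) ⟨
    suc (suc t) * V (suc m) (suc (suc t))
      ∎
    where open ≤-Reasoning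

  𝟙[_≤_] : ℕ → ℕ → ℕ
  𝟙[ zero  ≤ t     ] = 1
  𝟙[ suc r ≤ zero  ] = 0
  𝟙[ suc r ≤ suc t ] = 𝟙[ r ≤ t ]

  𝟙≤-≤1 : ∀ r t → 𝟙[ r ≤ t ] ≤ 1
  𝟙≤-≤1 zero    t       = ≤-refl
  𝟙≤-≤1 (suc r) zero    = z≤n
  𝟙≤-≤1 (suc r) (suc t) = 𝟙≤-≤1 r t

  𝟙≤-≰ : ∀ {r t} → ¬ r ≤ t → 𝟙[ r ≤ t ] ≡ 0
  𝟙≤-≰ {zero}  {t}     r≰t = ⊥-elim (r≰t z≤n)
  𝟙≤-≰ {suc r} {zero}  r≰t = refl
  𝟙≤-≰ {suc r} {suc t} r≰t = 𝟙≤-≰ (r≰t ∘ s≤s)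

  𝟙≤*𝟙≤-≰ : ∀ {r s t u} → ¬ r + s ≤ t + u → 𝟙[ r ≤ t ] * 𝟙[ s ≤ u ] ≡ 0
  𝟙≤*𝟙≤-≰ {zero}  {t = t}     {u} ≰ = trans (+-identityʳ _) (𝟙≤-≰ (λ s≤u → ≰ (≤-trans s≤u (m≤n+m u t))))
  𝟙≤*𝟙≤-≰ {suc r}     {t = zero}  ≰ = refl
  𝟙≤*𝟙≤-≰ {suc r}     {t = suc t} ≰ = 𝟙≤*𝟙≤-≰ {r} {t = t} (≰ ∘ s≤s)

  bitDistance : Bool → Bool → ℕ
  bitDistance true  true  = 0
  bitDistance false false = 0
  bitDistance true  false = 1
  bitDistance false true  = 1

  hamming : ∀ {n} → Vec Bool n → Vec Bool n → ℕ
  hamming []      []      = 0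
  hamming (a ∷ A) (b ∷ B) = bitDistance a b + hamming A B

  d≡hamming : ∀ {n} (A B : Vec Bool n) → d A B ≡ hamming A B
  d≡hamming []          []          = refl
  d≡hamming (true ∷ A)  (true ∷ B)  = d≡hamming A B
  d≡hamming (true ∷ A)  (false ∷ B) = cong suc (d≡hamming A B)
  d≡hamming (false ∷ A) (true ∷ B)  = trans (+-suc _ _) (cong suc (d≡hamming A B))
  d≡hamming (false ∷ A) (false ∷ B) = d≡hamming A B

  bitDistance-sym : ∀ a b → bitDistance a b ≡ bitDistance b a
  bitDistance-sym true  true  = refl
  bitDistance-sym true  false = refl
  bitDistance-sym false true  = refl
  bitDistance-sym false false = refl

  hamming-sym : ∀ {n} (A B : Vec Bool n) → hamming A B ≡ hamming B A
  hamming-sym []      []      = refl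
  hamming-sym (a ∷ A) (b ∷ B) = cong₂ _+_ (bitDistance-sym a b) (hamming-sym A B)

  bitDistance-triangle : ∀ a b c → bitDistance a c ≤ bitDistance a b + bitDistance b c
  bitDistance-triangle true  true  true  = z≤n
  bitDistance-triangle true  true  false = ≤-refl
  bitDistance-triangle true  false true  = z≤n
  bitDistance-triangle true  false false = ≤-refl
  bitDistance-triangle false true  true  = ≤-refl
  bitDistance-triangle false true  false = z≤n
  bitDistance-triangle false false true  = ≤-refl
  bitDistance-triangle false false false = z≤n

  hamming-triangle : ∀ {n} (A B C : Vec Bool n) → hamming A C ≤ hamming A B + hamming B C
  hamming-triangle []      []      []      = z≤n
  hamming-triangle (a ∷ A) (b ∷ B) (c ∷ C) = begin
    bitDistance a c + hamming A C
      ≤⟨ +-mono-≤ (bitDistance-triangle a b c) (hamming-triangle A B C) ⟩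
    (bitDistance a b + bitDistance b c) + (hamming A B + hamming B C)
      ≡⟨ interchange (bitDistance a b) (bitDistance b c) (hamming A B) (hamming B C) ⟩
    (bitDistance a b + hamming A B) + (bitDistance b c + hamming B C)
      ∎
    where open ≤-Reasoning

  sumCube : ∀ n → (Vec Bool n → ℕ) → ℕ
  sumCube zero    f = f []
  sumCube (suc n) f = sumCube n (λ y → f (false ∷ y)) + sumCube n (λ y → f (true ∷ y))

  sumCube-cong : ∀ n {f g : Vec Bool n → ℕ} → (∀ y → f y ≡ g y) → sumCube n f ≡ sumCube n g
  sumCube-cong zero    f≡g = f≡g []
  sumCube-cong (suc n) f≡g = cong₂ _+_ (sumCube-cong n (f≡g ∘ (false ∷_))) (sumCube-cong n (f≡g ∘ (true ∷_)))

  sumCube-mono-≤ : ∀ n {f g : Vec Bool n → ℕ} → (∀ y → f y ≤ g y) → sumCube n f ≤ sumCube n g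
  sumCube-mono-≤ zero    f≤g = f≤g []
  sumCube-mono-≤ (suc n) f≤g = +-mono-≤ (sumCube-mono-≤ n (f≤g ∘ (false ∷_))) (sumCube-mono-≤ n (f≤g ∘ (true ∷_)))

  sumCube-+ : ∀ n (f g : Vec Bool n → ℕ) → sumCube n (λ y → f y + g y) ≡ sumCube n f + sumCube n g
  sumCube-+ zero    f g = refl
  sumCube-+ (suc n) f g = begin
    sumCube n (λ y → f (false ∷ y) + g (false ∷ y)) + sumCube n (λ y → f (true ∷ y) + g (true ∷ y))
      ≡⟨ cong₂ _+_ (sumCube-+ n (f ∘ (false ∷_)) (g ∘ (false ∷_))) (sumCube-+ n (f ∘ (true ∷_)) (g ∘ (true ∷_))) ⟩
    (sumCube n (f ∘ (false ∷_)) + sumCube n (g ∘ (false ∷_))) + (sumCube n (f ∘ (true ∷_)) + sumCube n (g ∘ (true ∷_)))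
      ≡⟨ interchange (sumCube n (f ∘ (false ∷_))) _ _ _ ⟩
    sumCube (suc n) f + sumCube (suc n) g
      ∎
    where open ≡-Reasoning

  sumCube-0 : ∀ n → sumCube n (λ _ → 0) ≡ 0
  sumCube-0 zero    = refl
  sumCube-0 (suc n) = cong₂ _+_ (sumCube-0 n) (sumCube-0 n)

  sumCube-1 : ∀ n → sumCube n (λ _ → 1) ≡ 2 ^ n
  sumCube-1 zero    = refl
  sumCube-1 (suc n) = cong₂ _+_ (sumCube-1 n) (trans (sumCube-1 n) (sym (+-identityʳ (2 ^ n))))

  ball-volume  : ∀ {n} (A : Vec Bool n) t → sumCube n (λ y → 𝟙[ hamming A y ≤ t ]) ≡ V n t
  ball-volume⁻ : ∀ {n} (A : Vec Bool n) t → sumCube n (λ y → 𝟙[ suc (hamming A y) ≤ t ]) ≡ V⁻ n t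

  ball-volume []          t = sym (V-zero-dim t)
  ball-volume (true ∷ A)  t = trans (cong₂ _+_ (ball-volume⁻ A t) (ball-volume A t)) (V⁻+V≡V _ t)
  ball-volume (false ∷ A) t =
    trans (cong₂ _+_ (ball-volume A t) (ball-volume⁻ A t)) (trans (+-comm _ (V⁻ _ t)) (V⁻+V≡V _ t))

  ball-volume⁻ {n} A zero    = sumCube-0 n
  ball-volume⁻     A (suc t) = ball-volume A t

  ballIntersection : ∀ {n} → Vec Bool n → Vec Bool n → ℕ → ℕ
  ballIntersection {n} A B t = sumCube n (λ y → 𝟙[ hamming A y ≤ t ] * 𝟙[ hamming B y ≤ t ])

  ballIntersection-far : ∀ {n} (A B : Vec Bool n) t → ¬ hamming A B ≤ 2 * t → ballIntersection A B t ≡ 0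
  ballIntersection-far {n} A B t far = trans (sumCube-cong n disjoint) (sumCube-0 n)
    where
    disjoint : ∀ y → 𝟙[ hamming A y ≤ t ] * 𝟙[ hamming B y ≤ t ] ≡ 0
    disjoint y = 𝟙≤*𝟙≤-≰ {hamming A y} {hamming B y} {t} {t} λ close → far (begin
      hamming A B                 ≤⟨ hamming-triangle A y B ⟩
      hamming A y + hamming y B   ≡⟨ cong (hamming A y +_) (hamming-sym y B) ⟩
      hamming A y + hamming B y   ≤⟨ close ⟩
      t + t                       ≡⟨ cong (t +_) (+-identityʳ t) ⟨
      2 * t                       ∎)
      where open ≤-Reasoning

  +-≤-2* : ∀ {a b c} → a ≤ c → b ≤ c → a + b ≤ 2 * c
  +-≤-2* {c = c} a≤c b≤c = ≤-trans (+-mono-≤ a≤c b≤c) (≤-reflexive (cong (c +_) (sym (+-identityʳ c))))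

  ballIntersection-half-≤ : ∀ {m} (A B : Vec Bool m) t →
    sumCube m (λ y → 𝟙[ suc (hamming A y) ≤ t ] * 𝟙[ hamming B y ≤ t ]) ≤ V⁻ m t
  ballIntersection-half-≤ {m} A B t = begin
    sumCube m (λ y → 𝟙[ suc (hamming A y) ≤ t ] * 𝟙[ hamming B y ≤ t ])
      ≤⟨ sumCube-mono-≤ m (λ y → *-monoʳ-≤ 𝟙[ suc (hamming A y) ≤ t ] (𝟙≤-≤1 (hamming B y) t)) ⟩
    sumCube m (λ y → 𝟙[ suc (hamming A y) ≤ t ] * 1)
      ≡⟨ sumCube-cong m (λ y → *-identityʳ _) ⟩
    sumCube m (λ y → 𝟙[ suc (hamming A y) ≤ t ])
      ≡⟨ ball-volume⁻ A t ⟩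
    V⁻ m t
      ∎
    where open ≤-Reasoning

  ballIntersection-step-≤ : ∀ {m} (A B : Vec Bool (suc m)) → (∀ t → ballIntersection A B t ≤ 2 * V⁻ m t) → ∀ t →
    sumCube (suc m) (λ y → 𝟙[ suc (hamming A y) ≤ t ] * 𝟙[ suc (hamming B y) ≤ t ]) + ballIntersection A B t
      ≤ 2 * V⁻ (suc m) t
  ballIntersection-step-≤ {m} A B ih zero    =
    subst (λ z → z + ballIntersection A B 0 ≤ 0) (sym (sumCube-0 (suc m))) (ih 0)
  ballIntersection-step-≤ {m} A B ih (suc t) = begin
    ballIntersection A B t + ballIntersection A B (suc t)   ≤⟨ +-mono-≤ (ih t) (ih (suc t)) ⟩
    2 * V⁻ m t + 2 * V m t                                  ≡⟨ *-distribˡ-+ 2 (V⁻ m t) (V m t) ⟨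
    2 * (V⁻ m t + V m t)                                    ≡⟨ cong (2 *_) (V⁻+V≡V m t) ⟩
    2 * V (suc m) t                                         ∎
    where open ≤-Reasoning

  -- Split on the first coordinate: where A and B differ there, each half of the cube is
  -- at distance at least one from A or from B; where they agree, recurse on the tails.
  ballIntersection-≢ : ∀ {m} (A B : Vec Bool (suc m)) → A ≢ B → ∀ t → ballIntersection A B t ≤ 2 * V⁻ m t
  ballIntersection-≢ (true ∷ A) (false ∷ B) _ t =
    +-≤-2* (ballIntersection-half-≤ A B t)
           (subst (_≤ _) (sumCube-cong _ (λ y → *-comm _ 𝟙[ hamming A y ≤ t ])) (ballIntersection-half-≤ B A t))
  ballIntersection-≢ (false ∷ A) (true ∷ B) _ t =
    +-≤-2* (subst (_≤ _) (sumCube-cong _ (λ y → *-comm _ 𝟙[ hamming A y ≤ t ])) (ballIntersection-half-≤ B A t))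
           (ballIntersection-half-≤ A B t)
  ballIntersection-≢ {zero} (true ∷ [])  (true ∷ [])  A≢B t = ⊥-elim (A≢B refl)
  ballIntersection-≢ {zero} (false ∷ []) (false ∷ []) A≢B t = ⊥-elim (A≢B refl)
  ballIntersection-≢ {suc m} (true ∷ A) (true ∷ B) A≢B t =
    ballIntersection-step-≤ A B (ballIntersection-≢ A B (A≢B ∘ cong (true ∷_))) t
  ballIntersection-≢ {suc m} (false ∷ A) (false ∷ B) A≢B t =
    subst (_≤ 2 * V⁻ (suc m) t) (+-comm _ (ballIntersection A B t))
      (ballIntersection-step-≤ A B (ballIntersection-≢ A B (A≢B ∘ cong (false ∷_))) t)

  indicator+≤1+ : ∀ {b c p} → b ≤ 1 → c ≤ 1 + p → b + c ≤ 1 + (b * c + p)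
  indicator+≤1+                 z≤n       c≤1+p = c≤1+p
  indicator+≤1+ {c = c} {p = p} (s≤s z≤n) _     = s≤s (≤-trans (m≤m+n c 0) (m≤m+n (c + 0) p))

  module _ (t : ℕ) where

    nearCount : ∀ {n} → List (Vec Bool n) → Vec Bool n → ℕ
    nearCount []      y = 0
    nearCount (A ∷ L) y = 𝟙[ hamming A y ≤ t ] + nearCount L y

    nearPairs : ∀ {n} → List (Vec Bool n) → Vec Bool n → ℕ
    nearPairs []      y = 0
    nearPairs (A ∷ L) y = 𝟙[ hamming A y ≤ t ] * nearCount L y + nearPairs L y

    -- k ≤ 1 + k(k − 1)/2
    nearCount≤1+nearPairs : ∀ {n} (L : List (Vec Bool n)) y → nearCount L y ≤ 1 + nearPairs L y
    nearCount≤1+nearPairs []      y = z≤n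
    nearCount≤1+nearPairs (A ∷ L) y = indicator+≤1+ (𝟙≤-≤1 (hamming A y) t) (nearCount≤1+nearPairs L y)

    sumCube-nearCount : ∀ {n} (L : List (Vec Bool n)) → sumCube n (nearCount L) ≡ length L * V n t
    sumCube-nearCount {n} []      = sumCube-0 n
    sumCube-nearCount {n} (A ∷ L) =
      trans (sumCube-+ n (λ y → 𝟙[ hamming A y ≤ t ] ) (nearCount L)) (cong₂ _+_ (ball-volume A t) (sumCube-nearCount L))

    nearPairsWith : ∀ {n} → Vec Bool n → List (Vec Bool n) → ℕ
    nearPairsWith {n} A L = sumCube n (λ y → 𝟙[ hamming A y ≤ t ] * nearCount L y)

    nearPairsWith-∷ : ∀ {n} (A B : Vec Bool n) L → nearPairsWith A (B ∷ L) ≡ ballIntersection A B t + nearPairsWith A L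
    nearPairsWith-∷ {n} A B L = trans
      (sumCube-cong n (λ y → *-distribˡ-+ 𝟙[ hamming A y ≤ t ] 𝟙[ hamming B y ≤ t ] (nearCount L y)))
      (sumCube-+ n _ _)

    closeTo : ∀ {n} → Vec Bool n → List (Vec Bool n) → ℕ
    closeTo A L = length (filter (λ B → d A B ≤? 2 * t) L)

    nearPairsWith-≤ : ∀ {m} (A : Vec Bool (suc m)) L → All (A ≢_) L → nearPairsWith A L ≤ closeTo A L * (2 * V⁻ m t)
    nearPairsWith-≤ {m} A []      []           =
      ≤-reflexive (trans (sumCube-cong (suc m) (λ y → *-zeroʳ 𝟙[ hamming A y ≤ t ])) (sumCube-0 (suc m)))
    nearPairsWith-≤ {m} A (B ∷ L) (A≢B ∷ A≢L) with d A B ≤? 2 * t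
    ... | yes close = begin
      nearPairsWith A (B ∷ L)                      ≡⟨ nearPairsWith-∷ A B L ⟩
      ballIntersection A B t + nearPairsWith A L   ≤⟨ +-mono-≤ (ballIntersection-≢ A B A≢B t) (nearPairsWith-≤ A L A≢L) ⟩
      2 * V⁻ m t + closeTo A L * (2 * V⁻ m t)      ≡⟨ cong (λ z → length z * (2 * V⁻ m t)) (filter-accept (λ B → d A B ≤? 2 * t) close) ⟨
      closeTo A (B ∷ L) * (2 * V⁻ m t)             ∎
      where open ≤-Reasoning
    ... | no far = begin
      nearPairsWith A (B ∷ L)                      ≡⟨ nearPairsWith-∷ A B L ⟩
      ballIntersection A B t + nearPairsWith A L   ≡⟨ cong (_+ nearPairsWith A L) (ballIntersection-far A B t (far ∘ subst (_≤ 2 * t) (sym (d≡hamming A B)))) ⟩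
      nearPairsWith A L                            ≤⟨ nearPairsWith-≤ A L A≢L ⟩
      closeTo A L * (2 * V⁻ m t)                   ≡⟨ cong (λ z → length z * (2 * V⁻ m t)) (filter-reject (λ B → d A B ≤? 2 * t) far) ⟨
      closeTo A (B ∷ L) * (2 * V⁻ m t)             ∎
      where open ≤-Reasoning

    sumCube-nearPairs-≤ : ∀ {m} (L : List (Vec Bool (suc m))) → Unique L →
      sumCube (suc m) (nearPairs L) ≤ closePairs t L * (2 * V⁻ m t)
    sumCube-nearPairs-≤ {m} []      []           = ≤-reflexive (sumCube-0 (suc m))
    sumCube-nearPairs-≤ {m} (A ∷ L) (A≢L ∷ uniq) = begin
      sumCube (suc m) (nearPairs (A ∷ L))
        ≡⟨ sumCube-+ (suc m) (λ y → 𝟙[ hamming A y ≤ t ] * nearCount L y) (nearPairs L) ⟩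
      nearPairsWith A L + sumCube (suc m) (nearPairs L)
        ≤⟨ +-mono-≤ (nearPairsWith-≤ A L A≢L) (sumCube-nearPairs-≤ L uniq) ⟩
      closeTo A L * (2 * V⁻ m t) + closePairs t L * (2 * V⁻ m t)
        ≡⟨ *-distribʳ-+ (2 * V⁻ m t) (closeTo A L) (closePairs t L) ⟨
      closePairs t (A ∷ L) * (2 * V⁻ m t)
        ∎
      where open ≤-Reasoning

    code-size-≤ : ∀ {m} (L : List (Vec Bool (suc m))) → Unique L →
      length L * V (suc m) t ≤ 2 ^ suc m + closePairs t L * (2 * V⁻ m t)
    code-size-≤ {m} L uniq = begin
      length L * V (suc m) t                           ≡⟨ sumCube-nearCount L ⟨
      sumCube (suc m) (nearCount L)                    ≤⟨ sumCube-mono-≤ (suc m) (nearCount≤1+nearPairs L) ⟩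
      sumCube (suc m) (λ y → 1 + nearPairs L y)        ≡⟨ sumCube-+ (suc m) (λ _ → 1) (nearPairs L) ⟩
      sumCube (suc m) (λ _ → 1) + sumCube (suc m) (nearPairs L)
                                                       ≤⟨ +-mono-≤ (≤-reflexive (sumCube-1 (suc m))) (sumCube-nearPairs-≤ L uniq) ⟩
      2 ^ suc m + closePairs t L * (2 * V⁻ m t)        ∎
      where open ≤-Reasoning

module ClearingDenominators where

  open import Data.Integer as ℤ using (+_; -[1+_])
  import Data.Integer.Properties as ℤ
  open import Data.Nat as ℕ using (ℕ; suc; NonZero)
  import Data.Nat.Properties as ℕ
  open import Data.Nat.Solver using (module +-*-Solver)
  open import Data.Rational using (ℚ; mkℚ; 0ℚ; ½; _+_; _*_; _≤_; _/_; *≤*; toℚᵘ)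
  open import Data.Rational.Properties using (toℚᵘ-mono-≤; toℚᵘ-cancel-≤; toℚᵘ-fromℚᵘ; toℚᵘ-homo-+; toℚᵘ-homo-*)
  open import Data.Rational.Unnormalised as ℚᵘ using (mkℚᵘ; _≃_)
  import Data.Rational.Unnormalised.Properties as ℚᵘ
  open import Relation.Binary.PropositionalEquality

  open +-*-Solver

  toℚᵘ-/ : ∀ i d → toℚᵘ (i / suc d) ≃ mkℚᵘ i d
  toℚᵘ-/ i d = toℚᵘ-fromℚᵘ (mkℚᵘ i d)

  -- Read E = 2^n, q = V(n,t), W = V(n−1,t−1), x = a / D: from E / q + x ≤ c and
  -- c q ≤ E + 2PW we get x q ≤ 2PW, and n W ≤ t q then gives x n ≤ 2tP.
  excess-≤ : ∀ E c P W n t a D q .{{_ : NonZero q}} →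
    E ℕ.* D ℕ.+ a ℕ.* q ℕ.≤ c ℕ.* (q ℕ.* D) → c ℕ.* q ℕ.≤ E ℕ.+ P ℕ.* (2 ℕ.* W) → n ℕ.* W ℕ.≤ t ℕ.* q →
    a ℕ.* n ℕ.≤ P ℕ.* (D ℕ.* t ℕ.* 2)
  excess-≤ E c P W n t a D q sum≤c cq≤ nW≤tq = ℕ.*-cancelʳ-≤ (a ℕ.* n) (P ℕ.* (D ℕ.* t ℕ.* 2)) q (begin
    a ℕ.* n ℕ.* q                    ≡⟨ solve 3 (λ a n q → a :* n :* q := a :* q :* n) refl a n q ⟩
    a ℕ.* q ℕ.* n                    ≤⟨ ℕ.*-monoˡ-≤ n aq≤ ⟩
    P ℕ.* (2 ℕ.* W) ℕ.* D ℕ.* n      ≡⟨ solve 4 (λ P W D n → P :* (con 2 :* W) :* D :* n := con 2 :* P :* D :* (n :* W)) refl P W D n ⟩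
    2 ℕ.* P ℕ.* D ℕ.* (n ℕ.* W)      ≤⟨ ℕ.*-monoʳ-≤ (2 ℕ.* P ℕ.* D) nW≤tq ⟩
    2 ℕ.* P ℕ.* D ℕ.* (t ℕ.* q)      ≡⟨ solve 4 (λ P D t q → con 2 :* P :* D :* (t :* q) := P :* (D :* t :* con 2) :* q) refl P D t q ⟩
    P ℕ.* (D ℕ.* t ℕ.* 2) ℕ.* q      ∎)
    where
    open ℕ.≤-Reasoning
    aq≤ : a ℕ.* q ℕ.≤ P ℕ.* (2 ℕ.* W) ℕ.* D
    aq≤ = ℕ.+-cancelˡ-≤ (E ℕ.* D) _ _ (begin
      E ℕ.* D ℕ.+ a ℕ.* q                    ≤⟨ sum≤c ⟩
      c ℕ.* (q ℕ.* D)                        ≡⟨ ℕ.*-assoc c q D ⟨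
      c ℕ.* q ℕ.* D                          ≤⟨ ℕ.*-monoˡ-≤ D cq≤ ⟩
      (E ℕ.+ P ℕ.* (2 ℕ.* W)) ℕ.* D          ≡⟨ ℕ.*-distribʳ-+ D E (P ℕ.* (2 ℕ.* W)) ⟩
      E ℕ.* D ℕ.+ P ℕ.* (2 ℕ.* W) ℕ.* D      ∎)

  +≤ᵘ⇒cleared : ∀ E k a d c → mkℚᵘ (+ E) k ℚᵘ.+ mkℚᵘ (+ a) d ℚᵘ.≤ mkℚᵘ (+ c) 0 →
    E ℕ.* suc d ℕ.+ a ℕ.* suc k ℕ.≤ c ℕ.* (suc k ℕ.* suc d)
  +≤ᵘ⇒cleared E k a d c sum≤c = ℤ.drop‿+≤+ (subst₂ ℤ._≤_ lhs (sym (ℤ.pos-* c (suc k ℕ.* suc d))) (ℚᵘ.drop-*≤* sum≤c))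
    where
    lhs : (+ E ℤ.* + suc d ℤ.+ + a ℤ.* + suc k) ℤ.* + 1 ≡ + (E ℕ.* suc d ℕ.+ a ℕ.* suc k)
    lhs = begin
      (+ E ℤ.* + suc d ℤ.+ + a ℤ.* + suc k) ℤ.* + 1   ≡⟨ ℤ.*-identityʳ _ ⟩
      + E ℤ.* + suc d ℤ.+ + a ℤ.* + suc k             ≡⟨ cong₂ ℤ._+_ (ℤ.pos-* E (suc d)) (ℤ.pos-* a (suc k)) ⟨
      + (E ℕ.* suc d) ℤ.+ + (a ℕ.* suc k)             ≡⟨ ℤ.pos-+ (E ℕ.* suc d) (a ℕ.* suc k) ⟨
      + (E ℕ.* suc d ℕ.+ a ℕ.* suc k)                 ∎
      where open ≡-Reasoning

  cleared⇒*≤ᵘ : ∀ a d n s P → a ℕ.* n ℕ.≤ P ℕ.* (suc d ℕ.* suc s ℕ.* 2) →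
    mkℚᵘ (+ a) d ℚᵘ.* mkℚᵘ (+ n) s ℚᵘ.* mkℚᵘ (+ 1) 1 ℚᵘ.≤ mkℚᵘ (+ P) 0
  cleared⇒*≤ᵘ a d n s P an≤ = ℚᵘ.*≤* (subst₂ ℤ._≤_ lhs (ℤ.pos-* P _) (ℤ.+≤+ an≤))
    where
    lhs : + (a ℕ.* n) ≡ (+ a ℤ.* + n ℤ.* + 1) ℤ.* + 1
    lhs = sym (trans (ℤ.*-identityʳ _) (trans (ℤ.*-identityʳ _) (sym (ℤ.pos-* a n))))

  scaled-≤ : ∀ (E c P W n t q : ℕ) .{{_ : NonZero t}} .{{_ : NonZero q}} (x : ℚ) → 0ℚ ≤ x →
    (+ E) / q + x ≤ (+ c) / 1 → c ℕ.* q ℕ.≤ E ℕ.+ P ℕ.* (2 ℕ.* W) → n ℕ.* W ℕ.≤ t ℕ.* q →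
    x * ((+ n) / t) * ½ ≤ (+ P) / 1
  scaled-≤ E c P W n (suc s) (suc k) (mkℚ -[1+ _ ] _ _) (*≤* ())
  scaled-≤ E c P W n (suc s) (suc k) x@(mkℚ (+ a) d _) _ sum≤c cq≤ nW≤tq =
    toℚᵘ-cancel-≤ (ℚᵘ.≤-respˡ-≃ (ℚᵘ.≃-sym lhs) (ℚᵘ.≤-respʳ-≃ (ℚᵘ.≃-sym (toℚᵘ-/ (+ P) 0)) (cleared⇒*≤ᵘ a d n s P an≤)))
    where
    sum≤cᵘ : mkℚᵘ (+ E) k ℚᵘ.+ mkℚᵘ (+ a) d ℚᵘ.≤ mkℚᵘ (+ c) 0
    sum≤cᵘ = ℚᵘ.≤-respʳ-≃ (toℚᵘ-/ (+ c) 0) (ℚᵘ.≤-respˡ-≃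
      (ℚᵘ.≃-trans (toℚᵘ-homo-+ ((+ E) / suc k) x) (ℚᵘ.+-congˡ (mkℚᵘ (+ a) d) (toℚᵘ-/ (+ E) k))) (toℚᵘ-mono-≤ sum≤c))
    an≤ : a ℕ.* n ℕ.≤ P ℕ.* (suc d ℕ.* suc s ℕ.* 2)
    an≤ = excess-≤ E c P W n (suc s) a (suc d) (suc k) (+≤ᵘ⇒cleared E k a d c sum≤cᵘ) cq≤ nW≤tq
    lhs : toℚᵘ (x * ((+ n) / suc s) * ½) ≃ mkℚᵘ (+ a) d ℚᵘ.* mkℚᵘ (+ n) s ℚᵘ.* mkℚᵘ (+ 1) 1
    lhs = ℚᵘ.≃-trans (toℚᵘ-homo-* (x * ((+ n) / suc s)) ½)
            (ℚᵘ.*-cong (ℚᵘ.≃-trans (toℚᵘ-homo-* x ((+ n) / suc s)) (ℚᵘ.*-congˡ (toℚᵘ-/ (+ n) s)))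
                       (toℚᵘ-/ (+ 1) 1))

open import Data.Nat using (ℕ; NonZero; suc; _^_)
open import Data.Integer using (+_)
open import Data.Rational using (ℚ; 0ℚ; ½; _+_; _*_; _≤_; _/_)
open import Data.List using (List; length)
open import Data.List.Relation.Unary.Unique.Propositional using (Unique)
open import Data.Fin.Subset using (Subset)
open HammingBalls using (code-size-≤; [m+1]*V≤[t+1]*V)
open ClearingDenominators using (scaled-≤)

lemma5p2 : (n t : ℕ) → .{{_ : NonZero n}} → .{{_ : NonZero t}} →
           (x : ℚ) → 0ℚ ≤ x →
           (𝒞 : List (Subset n)) → Unique 𝒞 →
           H n t + x ≤ (+ length 𝒞) / 1 →
           x * ((+ n) / t) * ½ ≤ (+ closePairs t 𝒞) / 1
lemma5p2 (suc m) t@(suc s) x 0≤x 𝒞 uniq H+x≤|𝒞| =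
  scaled-≤ (2 ^ suc m) (length 𝒞) (closePairs t 𝒞) (V m s) (suc m) t (V (suc m) t)
    {{_}} {{V-nonZero (suc m) t}} x 0≤x H+x≤|𝒞| (code-size-≤ t 𝒞 uniq) ([m+1]*V≤[t+1]*V m s)
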